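{- Let $\mathcal S$ be the collection of left-c.e.\ semi-measures and $M$ a universal left-c.e.\ semi-measure. Then $\mathsf{MLR}_M=\bigcup_{\rho\in\mathcal S}\mathsf{MLR}_\rho$.
   Context: A semi-measure is $\rho:2^{<\omega}\to[0,1]$ with $\rho(\varepsilon)=1$ and $\rho(\sigma)\ge\rho(\sigma0)+\rho(\sigma1)$; it is left-c.e.\ if its values are uniformly approximable from below by a computable sequence of dyadic rationals. $M$ is universal: $M$ is left-c.e.\ and for every left-c.e.\ semi-measure $\rho$ there is $c$ with $\rho\le c\cdot M$. For prefix-free $E\subseteq2^{<\omega}$, $\rho(E)=\sum_{\sigma\in E}\rho(\sigma)$. A $\rho$-Martin-L\"of test is a uniformly c.e.\ sequence $(U_i)_{i\in\omega}$ of (prefix-free) subsets of $2^{<\omega}$ with $\rho(U_i)\le2^{ -i}$; $X\in\mathsf{MLR}_\rho$ iff for every such test $X\notin\bigcap_i\{Z\in2^\omega:\exists\sigma\in U_i\ \sigma\preceq Z\}$. -}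

module Defs where

open import Data.Nat as ℕ using (ℕ; zero; suc; _<_)
open import Data.Nat.Properties using (m^n≢0)
open import Data.Fin using (Fin)
open import Data.Vec using (Vec; []; _∷_; lookup; map)
open import Data.Bool using (Bool; true; false)
open import Data.List using (List; []; _∷_; length; foldr; _++_; [_])
open import Data.List.Relation.Unary.All using (All)
open import Data.List.Relation.Unary.Unique.Propositional using (Unique)
open import Data.Integer using (+_)
open import Data.Rational using (ℚ; _/_; _≤_; _+_; _*_; 0ℚ; 1ℚ; _-_)
open import Data.Product using (Σ; ∃; _×_; ∃-syntax)
open import Relation.Binary.PropositionalEquality using (_≡_)
open import Relation.Nullary using (¬_)

data Rec : ℕ → Set where
  zer  : ∀ {n} → Rec n
  succ : Rec 1
  proj : ∀ {n} → Fin n → Rec n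
  comp : ∀ {m n} → Rec m → Vec (Rec n) m → Rec n
  prec : ∀ {n} → Rec n → Rec (suc (suc n)) → Rec (suc n)
  mu   : ∀ {n} → Rec (suc n) → Rec n

mutual
  data _⟦_⟧⇓_ : ∀ {n} → Rec n → Vec ℕ n → ℕ → Set where
    ev-zer  : ∀ {n} {xs : Vec ℕ n} → zer ⟦ xs ⟧⇓ 0
    ev-succ : ∀ {x} → succ ⟦ x ∷ [] ⟧⇓ suc x
    ev-proj : ∀ {n} {i : Fin n} {xs} → proj i ⟦ xs ⟧⇓ lookup xs i
    ev-comp : ∀ {m n} {f : Rec m} {gs : Vec (Rec n) m} {xs ys y} →
              gs ⟦ xs ⟧⇓* ys → f ⟦ ys ⟧⇓ y → comp f gs ⟦ xs ⟧⇓ y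
    ev-prec0 : ∀ {n} {f : Rec n} {g xs y} →
               f ⟦ xs ⟧⇓ y → prec f g ⟦ 0 ∷ xs ⟧⇓ y
    ev-precS : ∀ {n} {f : Rec n} {g xs k y z} →
               prec f g ⟦ k ∷ xs ⟧⇓ y → g ⟦ k ∷ y ∷ xs ⟧⇓ z →
               prec f g ⟦ suc k ∷ xs ⟧⇓ z
    ev-mu   : ∀ {n} {f : Rec (suc n)} {xs y} →
              f ⟦ y ∷ xs ⟧⇓ 0 →
              (∀ z → z < y → ∃[ k ] (f ⟦ z ∷ xs ⟧⇓ suc k)) →
              mu f ⟦ xs ⟧⇓ y

  data _⟦_⟧⇓*_ : ∀ {m n} → Vec (Rec n) m → Vec ℕ n → Vec ℕ m → Set where
    ev-[] : ∀ {n} {xs : Vec ℕ n} → [] ⟦ xs ⟧⇓* []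
    ev-∷  : ∀ {m n} {g : Rec n} {gs : Vec (Rec n) m} {xs y ys} →
            g ⟦ xs ⟧⇓ y → gs ⟦ xs ⟧⇓* ys → (g ∷ gs) ⟦ xs ⟧⇓* (y ∷ ys)

Str : Set
Str = List Bool

Seq : Set
Seq = ℕ → Bool

-- standard bijective coding of 2^{<ω} into ℕ
code : Str → ℕ
code []          = 0
code (false ∷ σ) = suc (2 ℕ.* code σ)
code (true ∷ σ)  = suc (suc (2 ℕ.* code σ))

_↾_ : Seq → ℕ → Str
X ↾ zero  = []
X ↾ suc n = (X ↾ n) ++ [ X n ]

_≼_ : Str → Seq → Set
σ ≼ X = X ↾ length σ ≡ σ

_⊑_ : Str → Str → Set
σ ⊑ τ = ∃[ ρ ] (σ ++ ρ ≡ τ)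

dyadic : ℕ → ℕ → ℚ
dyadic p q = (+ p) / (2 ℕ.^ q) where instance _ = m^n≢0 2 q

2^-_ : ℕ → ℚ
2^- i = dyadic 1 i

-- A left-c.e. function ρ : 2^{<ω} → [0,1] is presented by a computable
-- (in the μ-recursive sense) approximation a σ s of dyadic rationals,
-- nondecreasing in s, with ρ(σ) = sup_s a σ s.  All properties of ρ
-- below are stated through this supremum.

Approx : Set
Approx = Str → ℕ → ℚ

IsLeftCEApprox : Approx → Set
IsLeftCEApprox a =
  Σ (Rec 2) λ eₙ → Σ (Rec 2) λ eₑ →
    (∀ σ s → ∃[ p ] ∃[ q ]
        (eₙ ⟦ code σ ∷ s ∷ [] ⟧⇓ p × eₑ ⟦ code σ ∷ s ∷ [] ⟧⇓ q × a σ s ≡ dyadic p q))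
  × (∀ σ s → a σ s ≤ a σ (suc s))

-- the function ρ = sup_s a(·,s) is a semi-measure with values in [0,1]:
--  ρ(σ) ≤ 1, ρ(ε) = 1, ρ(σ) ≥ ρ(σ0) + ρ(σ1)   (ρ ≥ 0 is automatic)
IsSemiMeasure : Approx → Set
IsSemiMeasure a =
    (∀ σ s → a σ s ≤ 1ℚ)
  × (∀ k → ∃[ s ] (1ℚ - 2^- k ≤ a [] s))
  × (∀ σ s → ∃[ t ] (a (σ ++ [ false ]) s + a (σ ++ [ true ]) s ≤ a σ t))

LeftCESemiMeasure : Approx → Set
LeftCESemiMeasure a = IsLeftCEApprox a × IsSemiMeasure a

-- ρ ≤ c · μ  (as functions on 2^{<ω}, i.e. between the suprema)
_≤[_]·_ : Approx → ℕ → Approx → Set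
a ≤[ c ]· b = ∀ σ s → ∃[ t ] (a σ s ≤ (+ c / 1) * b σ t)

Universal : Approx → Set
Universal m = LeftCESemiMeasure m ×
  (∀ a → LeftCESemiMeasure a → ∃[ c ] (a ≤[ c ]· m))

-- Martin-Löf tests.
-- A uniformly c.e. sequence (U_i) of subsets of 2^{<ω} is given by a
-- code e of a partial computable function: σ ∈ U_i iff e halts on (i, code σ).

_∈U[_]_ : Str → Rec 2 → ℕ → Set
σ ∈U[ e ] i = ∃[ y ] (e ⟦ i ∷ code σ ∷ [] ⟧⇓ y)

sumQ : List ℚ → ℚ
sumQ = foldr _+_ 0ℚ

mapL : ∀ {A B : Set} → (A → B) → List A → List B
mapL f []       = []
mapL f (x ∷ xs) = f x ∷ mapL f xs

-- ρ(U_i) ≤ 2^{-i}, where ρ(U_i) = Σ_{σ∈U_i} ρ(σ) = the supremum, over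
-- finite sets F ⊆ U_i and stages s, of Σ_{σ∈F} a σ s.
IsMLTest : Approx → Rec 2 → Set
IsMLTest a e =
    (∀ i σ τ → σ ∈U[ e ] i → τ ∈U[ e ] i → σ ⊑ τ → σ ≡ τ)
  × (∀ i (F : List Str) → Unique F → All (λ σ → σ ∈U[ e ] i) F →
       ∀ s → sumQ (mapL (λ σ → a σ s) F) ≤ 2^- i)

Covers : Rec 2 → Seq → Set
Covers e X = ∀ i → ∃[ σ ] (σ ∈U[ e ] i × σ ≼ X)

MLR : Approx → Seq → Set
MLR a X = ∀ e → IsMLTest a e → ¬ Covers e X

module Submission where

-- The inclusion ⊆ is immediate, since M itself is a left-c.e. semi-measure.
-- For ⊇ let ρ be left-c.e. with ρ ≤ c·M.  Any M-test (U_i) yields the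
-- shifted test V_i = U_{c+i}, again uniformly c.e. (precompose the program
-- with i ↦ c+i), and ρ(V_i) ≤ c·M(U_{c+i}) ≤ c·2^{-(c+i)} ≤ 2^{-i}, so
-- (V_i) is a ρ-test covering everything (U_i) covers.  Hence MLR_ρ ⊆ MLR_M.

open import Data.Nat as ℕ using (ℕ; zero; suc; _⊔_)
import Data.Nat.Properties as ℕP
open import Data.Integer as ℤ using (+_; +≤+)
import Data.Integer.Properties as ℤP
open import Data.Rational using (ℚ; _/_; _≤_; _*_; NonNegative; toℚᵘ)
import Data.Rational.Properties as ℚP
import Data.Rational.Unnormalised as ℚᵘ
import Data.Rational.Unnormalised.Properties as ℚᵘP
open import Data.Fin using () renaming (zero to fzero; suc to fsuc)
open import Data.Vec using ([]; _∷_)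
open import Data.List using (List; []; _∷_)
open import Data.List.Relation.Unary.All as All using (All)
open import Data.List.Relation.Unary.Unique.Propositional using (Unique)
open import Data.Product using (Σ; ∃-syntax; _×_; _,_; proj₁; proj₂)
open import Function.Bundles using (_⇔_; mk⇔)
open import Relation.Binary.PropositionalEquality using (_≡_; refl; sym; cong; subst)
open import Defs

-- The crude bound n ≤ 2^n, which makes c · 2^{-c} ≤ 1.
n≤2^n : ∀ n → n ℕ.≤ 2 ℕ.^ n
n≤2^n zero    = ℕ.z≤n
n≤2^n (suc n) = ℕP.+-mono-≤ (ℕP.m^n>0 2 n) (ℕP.≤-trans (n≤2^n n) (ℕP.m≤m+n (2 ℕ.^ n) 0))

toℚᵘ-/ : ∀ p d → toℚᵘ ((+ p) / suc d) ℚᵘ.≃ ℚᵘ.mkℚᵘ (+ p) d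
toℚᵘ-/ p d = ℚP.toℚᵘ-fromℚᵘ (ℚᵘ.mkℚᵘ (+ p) d)

scaled-reciprocal-≤ : ∀ a B D .{{_ : ℕ.NonZero B}} .{{_ : ℕ.NonZero D}} →
  a ℕ.* D ℕ.≤ B → ((+ a) / 1) * ((+ 1) / B) ≤ (+ 1) / D
scaled-reciprocal-≤ a (suc b) (suc d) aD≤B = ℚP.toℚᵘ-cancel-≤
  (ℚᵘP.≤-respʳ-≃ (ℚᵘP.≃-sym (toℚᵘ-/ 1 d))
    (ℚᵘP.≤-respˡ-≃ (ℚᵘP.≃-sym lhs≃) (ℚᵘ.*≤* cross)))
  where
  lhs≃ : toℚᵘ (((+ a) / 1) * ((+ 1) / suc b)) ℚᵘ.≃ ℚᵘ.mkℚᵘ (+ a) 0 ℚᵘ.* ℚᵘ.mkℚᵘ (+ 1) b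
  lhs≃ = ℚᵘP.≃-trans (ℚP.toℚᵘ-homo-* ((+ a) / 1) ((+ 1) / suc b))
                     (ℚᵘP.*-cong (toℚᵘ-/ a 0) (toℚᵘ-/ 1 b))

  -- the hypothesis and the cross-multiplied inequality, in the shape ℚᵘ uses
  aD≤B′ : a ℕ.* 1 ℕ.* suc d ℕ.≤ 1 ℕ.* suc (b ℕ.+ 0)
  aD≤B′ rewrite ℕP.*-identityʳ a | ℕP.+-identityʳ b | ℕP.*-identityˡ (suc b) = aD≤B

  cross : (+ a ℤ.* + 1) ℤ.* + suc d ℤ.≤ + 1 ℤ.* + suc (b ℕ.+ 0)
  cross = cast (+≤+ aD≤B′)
    where
    cast : + (a ℕ.* 1 ℕ.* suc d) ℤ.≤ + (1 ℕ.* suc (b ℕ.+ 0)) →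
              (+ a ℤ.* + 1) ℤ.* + suc d ℤ.≤ + 1 ℤ.* + suc (b ℕ.+ 0)
    cast h rewrite sym (ℤP.pos-* a 1) | sym (ℤP.pos-* (a ℕ.* 1) (suc d))
                    | sym (ℤP.pos-* 1 (suc (b ℕ.+ 0))) = h

scaled-dyadic-≤ : ∀ c i → ((+ c) / 1) * 2^- (c ℕ.+ i) ≤ 2^- i
scaled-dyadic-≤ c i =
  scaled-reciprocal-≤ c (2 ℕ.^ (c ℕ.+ i)) (2 ℕ.^ i)
    {{ℕP.m^n≢0 2 (c ℕ.+ i)}} {{ℕP.m^n≢0 2 i}}
    (subst (c ℕ.* 2 ℕ.^ i ℕ.≤_) (sym (ℕP.^-distribˡ-+-* 2 c i))
           (ℕP.*-monoˡ-≤ (2 ℕ.^ i) (n≤2^n c)))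

approx-mono : ∀ a → IsLeftCEApprox a → ∀ σ {s t} → s ℕ.≤ t → a σ s ≤ a σ t
approx-mono a (_ , _ , _ , step) σ {s} s≤t = go (ℕP.≤⇒≤′ s≤t)
  where
  go : ∀ {t} → s ℕ.≤′ t → a σ s ≤ a σ t
  go ℕ.≤′-refl       = ℚP.≤-refl
  go (ℕ.≤′-step s≤t) = ℚP.≤-trans (go s≤t) (step σ _)

mass : Approx → List Str → ℕ → ℚ
mass a F s = sumQ (mapL (λ σ → a σ s) F)

mass-dominated : ∀ ρ M c → IsLeftCEApprox M → ρ ≤[ c ]· M →
  ∀ F s → ∃[ t ] (∀ {t′} → t ℕ.≤ t′ → mass ρ F s ≤ ((+ c) / 1) * mass M F t′)
mass-dominated ρ M c leftM dom [] s =
  0 , λ _ → ℚP.≤-reflexive (sym (ℚP.*-zeroʳ ((+ c) / 1)))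
mass-dominated ρ M c leftM dom (σ ∷ F) s =
  tσ ⊔ tF , λ {t′} late → ℚP.≤-trans
    (ℚP.+-mono-≤
      (ℚP.≤-trans ρσ≤ (ℚP.*-monoˡ-≤-nonNeg C
        (approx-mono M leftM σ (ℕP.≤-trans (ℕP.m≤m⊔n tσ tF) late))))
      (ρF≤ (ℕP.≤-trans (ℕP.m≤n⊔m tσ tF) late)))
    (ℚP.≤-reflexive (sym (ℚP.*-distribˡ-+ C (M σ t′) (mass M F t′))))
  where
  C : ℚ
  C = (+ c) / 1
  instance
    C-nonNeg : NonNegative C
    C-nonNeg = ℚP.normalize-nonNeg c 1
  tσ = proj₁ (dom σ s)
  ρσ≤ = proj₂ (dom σ s)
  tF = proj₁ (mass-dominated ρ M c leftM dom F s)
  ρF≤ = proj₂ (mass-dominated ρ M c leftM dom F s)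

add : ℕ → Rec 2
add zero    = proj fzero
add (suc k) = comp succ (add k ∷ [])

add-halts : ∀ k i x → add k ⟦ i ∷ x ∷ [] ⟧⇓ (k ℕ.+ i)
add-halts zero    i x = ev-proj
add-halts (suc k) i x = ev-comp (ev-∷ (add-halts k i x) ev-[]) ev-succ

add-deterministic : ∀ k i x z → add k ⟦ i ∷ x ∷ [] ⟧⇓ z → z ≡ k ℕ.+ i
add-deterministic zero    i x z ev-proj = refl
add-deterministic (suc k) i x z (ev-comp (ev-∷ ev ev-[]) ev-succ) =
  cong suc (add-deterministic k i x _ ev)

shiftTest : ℕ → Rec 2 → Rec 2
shiftTest k e = comp e (add k ∷ proj (fsuc fzero) ∷ [])

shiftTest⇒ : ∀ k e i σ → σ ∈U[ shiftTest k e ] i → σ ∈U[ e ] (k ℕ.+ i)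
shiftTest⇒ k e i σ (y , ev-comp (ev-∷ evAdd (ev-∷ ev-proj ev-[])) evE)
  with add-deterministic k i (code σ) _ evAdd
... | refl = y , evE

shiftTest⇐ : ∀ k e i σ → σ ∈U[ e ] (k ℕ.+ i) → σ ∈U[ shiftTest k e ] i
shiftTest⇐ k e i σ (y , evE) =
  y , ev-comp (ev-∷ (add-halts k i (code σ)) (ev-∷ ev-proj ev-[])) evE

shiftTest-isMLTest : ∀ ρ M c e → IsLeftCEApprox M → ρ ≤[ c ]· M →
  IsMLTest M e → IsMLTest ρ (shiftTest c e)
shiftTest-isMLTest ρ M c e leftM dom (prefixFree , bounded) =
  prefixFree′ , bounded′
  where
  prefixFree′ : ∀ i σ τ → σ ∈U[ shiftTest c e ] i → τ ∈U[ shiftTest c e ] i →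
                σ ⊑ τ → σ ≡ τ
  prefixFree′ i σ τ σ∈ τ∈ =
    prefixFree (c ℕ.+ i) σ τ (shiftTest⇒ c e i σ σ∈) (shiftTest⇒ c e i τ τ∈)

  bounded′ : ∀ i (F : List Str) → Unique F → All (λ σ → σ ∈U[ shiftTest c e ] i) F →
             ∀ s → mass ρ F s ≤ 2^- i
  bounded′ i F unique F⊆V s = ℚP.≤-trans (proj₂ (mass-dominated ρ M c leftM dom F s) ℕP.≤-refl)
    (ℚP.≤-trans (ℚP.*-monoˡ-≤-nonNeg ((+ c) / 1) {{ℚP.normalize-nonNeg c 1}}
                  (bounded (c ℕ.+ i) F unique (All.map (shiftTest⇒ c e i _) F⊆V) _))
                (scaled-dyadic-≤ c i))

shiftTest-covers : ∀ k e X → Covers e X → Covers (shiftTest k e) X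
shiftTest-covers k e X covered i =
  let (σ , σ∈ , σ≼X) = covered (k ℕ.+ i) in σ , shiftTest⇐ k e i σ σ∈ , σ≼X

MLR-dominated : ∀ ρ M c → IsLeftCEApprox M → ρ ≤[ c ]· M →
  ∀ X → MLR ρ X → MLR M X
MLR-dominated ρ M c leftM dom X randomρ e testM covered =
  randomρ (shiftTest c e) (shiftTest-isMLTest ρ M c e leftM dom testM)
          (shiftTest-covers c e X covered)

proposition5p2 : (M : Approx) → Universal M →
    ∀ (X : Seq) → MLR M X ⇔ Σ Approx (λ ρ → LeftCESemiMeasure ρ × MLR ρ X)
proposition5p2 M (semiM , universal) X = mk⇔ (λ randomM → M , semiM , randomM) fromSome
  where
  fromSome : Σ Approx (λ ρ → LeftCESemiMeasure ρ × MLR ρ X) → MLR M X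
  fromSome (ρ , semiρ , randomρ) =
    let (c , dom) = universal ρ semiρ
    in MLR-dominated ρ M c (proj₁ semiM) dom X randomρ
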